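{- Let $k$, $p$, $v$ and $w$ be positive integers with $k > p$. Let $a, b, m$ be the unique integers with $v = \binom{a}{k} + \binom{b}{k-1} + m$, $a > b$ and $\binom{b}{k-2} > m \ge 0$. If $$w \ge \binom{a}{p} + \binom{b}{p-1} + c_p^k(m),$$ then the construction described below (applied with target numbers $v$ and $w$) does not fail and produces a flag complex $\Delta$ with $f_{k-1}(\Delta) = v$ and $f_{p-1}(\Delta) = w$.
   Context: A simplicial complex $\Delta$ on a vertex set is a family of subsets (faces) closed under taking subsets and containing all singletons; $f_{i-1}(\Delta)$ is the number of faces with $i$ vertices. A flag complex is a simplicial complex in which every minimal non-face has two elements; equivalently, it is the clique complex of a graph (faces = vertex sets of cliques). Binomial coefficients follow the convention $\binom{n}{j} = 0$ if $n < j$. For an integer $m > 0$, $g_k(m)$ is the unique integer with $\binom{g_k(m)}{k-1} \le m < \binom{g_k(m)+1}{k-1}$, and $c_p^k$ is defined on integers $m \ge 0$ by $c_p^k(0) = 0$ and $c_p^k(m) = \binom{g_k(m)}{p-1} + c_p^k\!\left(m - \binom{g_k(m)}{k-1}\right)$ for $m > 0$. The construction (target $f_{k-1} = v$, $f_{p-1} = w$): let $n_0$ be the unique integer with $\binom{n_0}{k} \le v < \binom{n_0+1}{k}$, and $m_0 = v - \binom{n_0}{k}$. For $i \ge 1$: if $m_{i-1} = 0$, set $z = i-1$ and stop; otherwise let $n_i$ be the unique integer with $\binom{n_i}{k-1} \le m_{i-1} < \binom{n_i+1}{k-1}$ and $m_i = m_{i-1} - \binom{n_i}{k-1}$. Form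 the graph consisting of a clique on $n_0$ vertices together with $z$ further vertices $v_1, \dots, v_z$, where $v_i$ is adjacent to exactly $n_i$ vertices of the clique (and to no other vertices), and let $\Delta$ be its clique complex. If $f_{p-1}(\Delta) > w$ the construction fails. Otherwise add $w - f_{p-1}(\Delta)$ new vertices, each adjacent to exactly $p-1$ vertices of the original $n_0$-clique, and take the clique complex of the resulting graph. -}

module Defs where

open import Data.Nat using (ℕ; zero; suc; _+_; _∸_; _<ᵇ_; _≡ᵇ_; _≤ᵇ_)
open import Data.Nat.Combinatorics using (_C_)
open import Data.Bool using (Bool; true; false; if_then_else_; _∧_; _∨_; not)
open import Data.Fin using (Fin; toℕ; _≟_)
open import Data.Fin.Subset using (Subset; ∣_∣)
open import Data.List using (List; []; _∷_; _++_; length; filter; map; replicate)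
open import Data.List as L using ()
open import Data.Vec using (Vec; []; _∷_)
open import Data.Vec as V using ()
open import Relation.Nullary.Decidable using (⌊_⌋; _×-dec_)
import Data.Bool as B
open import Data.Nat as N using ()

topBelow : ℕ → ℕ → ℕ → ℕ
topBelow j m zero    = zero
topBelow j m (suc b) = if (suc b) C j ≤ᵇ m then suc b else topBelow j m b

-- top j m : the unique n with  n C j ≤ m < (n+1) C j  (for j ≥ 1, m ≥ 1,
-- or j ≥ 1 and m ≥ 0 when such n exists).  Such n always satisfies
-- n ≤ m + j (since n C j ≥ n - j + 1 for j ≥ 1), so searching below
-- m + j finds it.
top : ℕ → ℕ → ℕ
top j m = topBelow j m (m + j)

g : ℕ → ℕ → ℕ
g k m = top (k ∸ 1) m

-- c_p^k(m), defined by the recursion of the paper; the fuel argument is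
-- m itself, which suffices since each step strictly decreases m.
cFuel : ℕ → ℕ → ℕ → ℕ → ℕ
cFuel p k zero       m = zero
cFuel p k (suc fuel) zero = zero
cFuel p k (suc fuel) (suc m) =
  (g k (suc m)) C (p ∸ 1) + cFuel p k fuel (suc m ∸ (g k (suc m)) C (k ∸ 1))

c : ℕ → ℕ → ℕ → ℕ
c p k m = cFuel p k m m

record Graph (n : ℕ) : Set where
  field
    adj : Fin n → Fin n → Bool

open Graph public

allSubsets : (n : ℕ) → List (Subset n)
allSubsets zero    = [] ∷ []
allSubsets (suc n) = map (true ∷_) (allSubsets n) ++ map (false ∷_) (allSubsets n)

allB : {A : Set} → (A → Bool) → List A → Bool
allB P []       = true
allB P (x ∷ xs) = P x ∧ allB P xs

isClique : ∀ {n} → Graph n → Subset n → Bool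
isClique {n} G S =
  allB (λ x → allB (λ y →
        not (V.lookup S x ∧ V.lookup S y ∧ not ⌊ x ≟ y ⌋) ∨ adj G x y)
      (L.allFin n)) (L.allFin n)

-- f_{i-1}(Δ(G)) : number of faces with i vertices of the clique complex
-- of G, i.e. the number of i-element cliques of G.
fClique : ∀ {n} → Graph n → ℕ → ℕ
fClique {n} G i =
  length (filter (λ S → (∣ S ∣ N.≟ i) ×-dec (isClique G S B.≟ true))
                 (allSubsets n))

-- the sequence n_1, n_2, ..., n_z obtained from m_0 (fuel = m_0 suffices)
nsFuel : ℕ → ℕ → ℕ → List ℕ
nsFuel k zero       m       = []
nsFuel k (suc fuel) zero    = []
nsFuel k (suc fuel) (suc m) =
  g k (suc m) ∷ nsFuel k fuel (suc m ∸ (g k (suc m)) C (k ∸ 1))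

n₀ : ℕ → ℕ → ℕ
n₀ k v = top k v

m₀ : ℕ → ℕ → ℕ
m₀ k v = v ∸ (n₀ k v) C k

ns : ℕ → ℕ → List ℕ
ns k v = nsFuel k (m₀ k v) (m₀ k v)

-- Graph consisting of a clique on the vertices 0, ..., a-1 together with
-- further vertices a + j (j < length L), where vertex a + j is adjacent
-- exactly to the clique vertices 0, ..., (L[j]) - 1 and to nothing else.
attachGraph : (a : ℕ) (L : List ℕ) → Graph (a + length L)
attachGraph a L = record { adj = A }
  where
  att : ℕ → ℕ
  att j = L.foldr (λ x r j' → if j' ≡ᵇ 0 then x else r (j' ∸ 1)) (λ _ → 0) L j
  A : Fin (a + length L) → Fin (a + length L) → Bool
  A x y =
    let i = toℕ x ; j = toℕ y in
    not (i ≡ᵇ j) ∧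
      ( ((i <ᵇ a) ∧ (j <ᵇ a))
      ∨ ((i <ᵇ a) ∧ not (j <ᵇ a) ∧ (i <ᵇ att (j ∸ a)))
      ∨ ((j <ᵇ a) ∧ not (i <ᵇ a) ∧ (j <ᵇ att (i ∸ a))) )

G₀ : (k v : ℕ) → Graph (n₀ k v + length (ns k v))
G₀ k v = attachGraph (n₀ k v) (ns k v)

Gfinal : (k p v e : ℕ) → Graph (n₀ k v + length (ns k v L.++ replicate e (p ∸ 1)))
Gfinal k p v e = attachGraph (n₀ k v) (ns k v L.++ replicate e (p ∸ 1))

-- The whole proof rests on one counting formula.  For a graph made of an
-- a-clique plus extra vertices, the extra vertex j being joined to L[j] ≤ a
-- clique vertices, the number of (i+1)-cliques is
--     (a choose i+1) + Σ_j (L[j] choose i)                (fClique-attachGraph).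
-- Next, the search function top of Defs is shown to compute the greedy
-- binomial index (top-unique), so that for v = (a choose k) + (b choose k-1)
-- + m the construction has n_0 = a, all n_i ≤ a, Σ (n_i choose k-1) = m_0
-- and Σ (n_i choose p-1) ≤ (b choose p-1) + c_p^k(m) (module Greedy).

module Submission where

open import Defs
open import Algebra.Bundles using (CommutativeMonoid)
open import Data.Bool using (Bool; true; false; if_then_else_; _∧_; _∨_; not; T)
import Data.Bool as Bool
open import Data.Bool.Properties using (∧-assoc; ∧-zeroʳ; ∨-distribˡ-∧; ∧-commutativeMonoid)
open import Data.Empty using (⊥-elim)
open import Data.Fin using (Fin; toℕ) renaming (zero to fzero; suc to fsuc)
import Data.Fin as Fin
open import Data.Fin.Subset using (Subset; ∣_∣)
open import Data.List using (List; []; _∷_; _++_; length; map; filter; replicate)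
import Data.List as List
open import Data.List.Properties using (length-map)
open import Data.List.Relation.Unary.All using (All; []; _∷_)
open import Data.List.Relation.Unary.All.Properties using (gmap⁺; ++⁺; replicate⁺)
open import Data.Nat using (ℕ; zero; suc; _+_; _*_; _∸_; _≡ᵇ_; _<ᵇ_; _≤ᵇ_; _≤_; _<_; _>_; _≥_; pred; z≤n; s≤s; s≤s⁻¹)
import Data.Nat as ℕ
open import Data.Nat.Combinatorics using (_C_; nCk+nC[k+1]≡[n+1]C[k+1]; nC1≡n; nCn≡1; k>n⇒nCk≡0)
open import Data.Nat.Properties
open import Data.Product using (_×_; _,_)
open import Data.Sum using (inj₁; inj₂)
open import Data.Unit using (tt)
open import Data.Vec using ([]; _∷_; lookup)
open import Function using (_∘_)
open import Relation.Binary.Definitions using (tri<; tri≈; tri>)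
open import Relation.Binary.PropositionalEquality
open import Relation.Nullary.Decidable using (⌊_⌋; does; _×-dec_; yes; no)
open import Relation.Unary using (Pred; Decidable)
open import Algebra.Properties.CommutativeSemigroup (CommutativeMonoid.commutativeSemigroup ∧-commutativeMonoid) using () renaming (interchange to ∧-interchange)
open import Algebra.Properties.CommutativeSemigroup +-commutativeSemigroup using () renaming (interchange to +-interchange)

count : {A : Set} → (A → Bool) → List A → ℕ
count q []       = 0
count q (x ∷ xs) = (if q x then 1 else 0) + count q xs

length-filter≡count : ∀ {ℓ} {A : Set} {P : Pred A ℓ} (P? : Decidable P) (q : A → Bool) →
  (∀ x → does (P? x) ≡ q x) → ∀ xs → length (filter P? xs) ≡ count q xs
length-filter≡count P? q agree [] = refl
length-filter≡count P? q agree (x ∷ xs) rewrite sym (agree x) with does (P? x)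
... | true  = cong suc (length-filter≡count P? q agree xs)
... | false = length-filter≡count P? q agree xs

count-cong : {A : Set} {q r : A → Bool} → (∀ x → q x ≡ r x) → ∀ xs → count q xs ≡ count r xs
count-cong q≗r []       = refl
count-cong q≗r (x ∷ xs) = cong₂ _+_ (cong (λ t → if t then 1 else 0) (q≗r x)) (count-cong q≗r xs)

count-++ : {A : Set} (q : A → Bool) (xs ys : List A) → count q (xs ++ ys) ≡ count q xs + count q ys
count-++ q []       ys = refl
count-++ q (x ∷ xs) ys =
  trans (cong (_ +_) (count-++ q xs ys)) (sym (+-assoc (if q x then 1 else 0) _ _))

count-map : {A B : Set} (q : B → Bool) (f : A → B) (xs : List A) → count q (map f xs) ≡ count (q ∘ f) xs
count-map q f []       = refl
count-map q f (x ∷ xs) = cong (_ +_) (count-map q f xs)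

count-never : {A : Set} (xs : List A) → count (λ _ → false) xs ≡ 0
count-never []       = refl
count-never (x ∷ xs) = count-never xs

every : (n : ℕ) → (Fin n → Bool) → Bool
every zero    t = true
every (suc n) t = t fzero ∧ every n (t ∘ fsuc)

every-cong : ∀ n {s t : Fin n → Bool} → (∀ x → s x ≡ t x) → every n s ≡ every n t
every-cong zero    s≗t = refl
every-cong (suc n) s≗t = cong₂ _∧_ (s≗t fzero) (every-cong n (s≗t ∘ fsuc))

every-∧ : ∀ n (s t : Fin n → Bool) → every n (λ x → s x ∧ t x) ≡ every n s ∧ every n t
every-∧ zero    s t = refl
every-∧ (suc n) s t =
  trans (cong ((s fzero ∧ t fzero) ∧_) (every-∧ n (s ∘ fsuc) (t ∘ fsuc)))
        (∧-interchange (s fzero) (t fzero) (every n (s ∘ fsuc)) (every n (t ∘ fsuc)))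

every-guard : ∀ n b (t : Fin n → Bool) → every n (λ x → not b ∨ t x) ≡ not b ∨ every n t
every-guard n true  t = refl
every-guard zero    false t = refl
every-guard (suc n) false t = every-guard n false (t ∘ fsuc)

allB-allFin : ∀ n (t : Fin n → Bool) → allB t (List.allFin n) ≡ every n t
allB-allFin n t = go n (λ x → x)
  where
  go : ∀ m (f : Fin m → Fin n) → allB t (List.tabulate f) ≡ every m (t ∘ f)
  go zero    f = refl
  go (suc m) f = cong (t (f fzero) ∧_) (go m (f ∘ fsuc))

pairOK : ∀ {n} → Subset n → (Fin n → Fin n → Bool) → Fin n → Fin n → Bool
pairOK S F x y = not (lookup S x ∧ lookup S y ∧ not ⌊ x Fin.≟ y ⌋) ∨ F x y

cliqueFin : ∀ n → Subset n → (Fin n → Fin n → Bool) → Bool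
cliqueFin n S F = every n (λ x → every n (λ y → pairOK S F x y))

isClique≡cliqueFin : ∀ {n} (G : Graph n) S → isClique G S ≡ cliqueFin n S (adj G)
isClique≡cliqueFin {n} G S =
  trans (allB-allFin n _) (every-cong n (λ x → allB-allFin n (pairOK S (adj G) x)))

isYes-≟-fsuc : ∀ {n} (x y : Fin n) → ⌊ fsuc x Fin.≟ fsuc y ⌋ ≡ ⌊ x Fin.≟ y ⌋
isYes-≟-fsuc x y with x Fin.≟ y
... | yes _ = refl
... | no  _ = refl

pairOK-fsuc : ∀ {n} b (S : Subset n) (F : Fin (suc n) → Fin (suc n) → Bool) x y →
  pairOK (b ∷ S) F (fsuc x) (fsuc y) ≡ pairOK S (λ x′ y′ → F (fsuc x′) (fsuc y′)) x y
pairOK-fsuc b S F x y =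
  cong (λ e → not (lookup S x ∧ lookup S y ∧ not e) ∨ F (fsuc x) (fsuc y)) (isYes-≟-fsuc x y)

pairOK-diagonal : ∀ b f → not (b ∧ b ∧ false) ∨ f ≡ true
pairOK-diagonal true  f = refl
pairOK-diagonal false f = refl

pairOK-first : ∀ b s f g →
  (not (b ∧ s ∧ true) ∨ f) ∧ (not (s ∧ b ∧ true) ∨ g) ≡ not b ∨ (not s ∨ (f ∧ g))
pairOK-first true  true  f g = refl
pairOK-first true  false f g = refl
pairOK-first false true  f g = refl
pairOK-first false false f g = refl

cliqueFin-∷ : ∀ n b S (F : Fin (suc n) → Fin (suc n) → Bool) →
  cliqueFin (suc n) (b ∷ S) F
    ≡ (not b ∨ every n (λ y → not (lookup S y) ∨ (F fzero (fsuc y) ∧ F (fsuc y) fzero)))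
      ∧ cliqueFin n S (λ x y → F (fsuc x) (fsuc y))
cliqueFin-∷ n b S F = begin
    (diagonal ∧ every n row) ∧ every n (λ x → column x ∧ every n (pairOK (b ∷ S) F (fsuc x) ∘ fsuc))
  ≡⟨ cong₂ _∧_ (cong (_∧ every n row) (pairOK-diagonal b (F fzero fzero)))
       (every-cong n (λ x → cong (column x ∧_) (every-cong n (pairOK-fsuc b S F x)))) ⟩
    every n row ∧ every n (λ x → column x ∧ every n (pairOK S F′ x))
  ≡⟨ cong (every n row ∧_) (every-∧ n column (λ x → every n (pairOK S F′ x))) ⟩
    every n row ∧ (every n column ∧ cliqueFin n S F′)
  ≡⟨ sym (∧-assoc (every n row) (every n column) (cliqueFin n S F′)) ⟩
    (every n row ∧ every n column) ∧ cliqueFin n S F′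
  ≡⟨ cong (_∧ cliqueFin n S F′) (sym (every-∧ n row column)) ⟩
    every n (λ y → row y ∧ column y) ∧ cliqueFin n S F′
  ≡⟨ cong (_∧ cliqueFin n S F′) (every-cong n (λ y →
       pairOK-first b (lookup S y) (F fzero (fsuc y)) (F (fsuc y) fzero))) ⟩
    every n (λ y → not b ∨ (not (lookup S y) ∨ both y)) ∧ cliqueFin n S F′
  ≡⟨ cong (_∧ cliqueFin n S F′) (every-guard n b (λ y → not (lookup S y) ∨ both y)) ⟩
    (not b ∨ every n (λ y → not (lookup S y) ∨ both y)) ∧ cliqueFin n S F′
  ∎
  where
  open ≡-Reasoning
  F′ : Fin n → Fin n → Bool
  F′ x y = F (fsuc x) (fsuc y)
  diagonal : Bool
  diagonal = pairOK (b ∷ S) F fzero fzero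
  row column both : Fin n → Bool
  row    y = pairOK (b ∷ S) F fzero (fsuc y)
  column x = pairOK (b ∷ S) F (fsuc x) fzero
  both   y = F fzero (fsuc y) ∧ F (fsuc y) fzero

-- Relations and vertex sets on ℕ; vertex x of Fin n is named toℕ x.
shift : (ℕ → ℕ → Bool) → ℕ → ℕ → Bool
shift H x y = H (suc x) (suc y)

adjacentToFirst : (ℕ → ℕ → Bool) → ℕ → Bool
adjacentToFirst H y = H 0 (suc y) ∧ H (suc y) 0

within : ∀ {n} → Subset n → (ℕ → Bool) → Bool
within []      V = true
within (b ∷ S) V = (not b ∨ V 0) ∧ within S (V ∘ suc)

cliqueℕ : ∀ {n} → Subset n → (ℕ → ℕ → Bool) → Bool
cliqueℕ []      H = true
cliqueℕ (b ∷ S) H = (not b ∨ within S (adjacentToFirst H)) ∧ cliqueℕ S (shift H)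

every≡within : ∀ {n} (S : Subset n) (W : Fin n → Bool) (V : ℕ → Bool) → (∀ y → W y ≡ V (toℕ y)) →
  every n (λ y → not (lookup S y) ∨ W y) ≡ within S V
every≡within []      W V W≗V = refl
every≡within (b ∷ S) W V W≗V =
  cong₂ _∧_ (cong (not b ∨_) (W≗V fzero)) (every≡within S (W ∘ fsuc) (V ∘ suc) (W≗V ∘ fsuc))

cliqueFin≡cliqueℕ : ∀ {n} (S : Subset n) (F : Fin n → Fin n → Bool) (H : ℕ → ℕ → Bool) →
  (∀ x y → F x y ≡ H (toℕ x) (toℕ y)) → cliqueFin n S F ≡ cliqueℕ S H
cliqueFin≡cliqueℕ []            F H F≗H = refl
cliqueFin≡cliqueℕ {suc n} (b ∷ S) F H F≗H = trans (cliqueFin-∷ n b S F)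
  (cong₂ _∧_ (cong (not b ∨_) (every≡within S _ _ (λ y → cong₂ _∧_ (F≗H fzero (fsuc y)) (F≗H (fsuc y) fzero))))
             (cliqueFin≡cliqueℕ S _ (shift H) (λ x y → F≗H (fsuc x) (fsuc y))))

isClique≡cliqueℕ : ∀ {n} (G : Graph n) (H : ℕ → ℕ → Bool) →
  (∀ x y → adj G x y ≡ H (toℕ x) (toℕ y)) → ∀ S → isClique G S ≡ cliqueℕ S H
isClique≡cliqueℕ {n} G H G≗H S = trans (isClique≡cliqueFin G S) (cliqueFin≡cliqueℕ S (adj G) H G≗H)

within-∧ : ∀ {n} (S : Subset n) V W → within S V ∧ within S W ≡ within S (λ y → V y ∧ W y)
within-∧ []      V W = refl
within-∧ (b ∷ S) V W =
  trans (∧-interchange (not b ∨ V 0) (within S (V ∘ suc)) (not b ∨ W 0) (within S (W ∘ suc)))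
        (cong₂ _∧_ (sym (∨-distribˡ-∧ (not b) (V 0) (W 0))) (within-∧ S (V ∘ suc) (W ∘ suc)))

within-everything : ∀ {n} (S : Subset n) → within S (λ _ → true) ≡ true
within-everything []          = refl
within-everything (false ∷ S) = within-everything S
within-everything (true  ∷ S) = within-everything S

-- cliques n H U i : the number of i-element cliques of H among the vertices
-- 0, …, n-1 that lie inside U (the empty clique always counts).  Such a
-- clique either avoids vertex 0, or is vertex 0 (if allowed) together with
-- a clique inside its neighbourhood.
cliques : ℕ → (ℕ → ℕ → Bool) → (ℕ → Bool) → ℕ → ℕ
cliques n       H U zero    = 1
cliques zero    H U (suc i) = 0
cliques (suc n) H U (suc i) =
  cliques n (shift H) (U ∘ suc) (suc i)
  + (if U 0 then cliques n (shift H) (λ y → U (suc y) ∧ adjacentToFirst H y) i else 0)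

isCliqueIn : ∀ {n} → (ℕ → ℕ → Bool) → (ℕ → Bool) → ℕ → Subset n → Bool
isCliqueIn H U i S = (∣ S ∣ ≡ᵇ i) ∧ (within S U ∧ cliqueℕ S H)

count-cliques : (n : ℕ) (H : ℕ → ℕ → Bool) (U : ℕ → Bool) (i : ℕ) → count (isCliqueIn H U i) (allSubsets n) ≡ cliques n H U i

count-containing-first : (n : ℕ) (H : ℕ → ℕ → Bool) (U : ℕ → Bool) (i : ℕ) →
  count (λ S → isCliqueIn H U (suc i) (true ∷ S)) (allSubsets n)
    ≡ (if U 0 then cliques n (shift H) (λ y → U (suc y) ∧ adjacentToFirst H y) i else 0)
count-containing-first n H U i with U 0
... | false = trans (count-cong (λ S → ∧-zeroʳ (∣ S ∣ ≡ᵇ i)) (allSubsets n)) (count-never (allSubsets n))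
... | true  = trans (count-cong (λ S → cong ((∣ S ∣ ≡ᵇ i) ∧_) (merge S)) (allSubsets n))
                    (count-cliques n (shift H) _ i)
  where
  merge : ∀ S → within S (U ∘ suc) ∧ (within S (adjacentToFirst H) ∧ cliqueℕ S (shift H))
              ≡ within S (λ y → U (suc y) ∧ adjacentToFirst H y) ∧ cliqueℕ S (shift H)
  merge S = trans (sym (∧-assoc (within S (U ∘ suc)) _ _))
                  (cong (_∧ cliqueℕ S (shift H)) (within-∧ S (U ∘ suc) (adjacentToFirst H)))

count-cliques zero    H U zero    = refl
count-cliques zero    H U (suc i) = refl
count-cliques (suc n) H U i = begin
    count (isCliqueIn H U i) (map (true ∷_) subsets ++ map (false ∷_) subsets)
  ≡⟨ count-++ (isCliqueIn H U i) (map (true ∷_) subsets) (map (false ∷_) subsets) ⟩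
    count (isCliqueIn H U i) (map (true ∷_) subsets) + count (isCliqueIn H U i) (map (false ∷_) subsets)
  ≡⟨ cong₂ _+_ (count-map (isCliqueIn H U i) (true ∷_) subsets) (count-map (isCliqueIn H U i) (false ∷_) subsets) ⟩
    count (λ S → isCliqueIn H U i (true ∷ S)) subsets + count (isCliqueIn (shift H) (U ∘ suc) i) subsets
  ≡⟨ split i ⟩
    cliques (suc n) H U i
  ∎
  where
  open ≡-Reasoning
  subsets : List (Subset n)
  subsets = allSubsets n
  split : ∀ i → count (λ S → isCliqueIn H U i (true ∷ S)) subsets
                + count (isCliqueIn (shift H) (U ∘ suc) i) subsets ≡ cliques (suc n) H U i
  split zero    = trans (cong (_+ count (isCliqueIn (shift H) (U ∘ suc) zero) subsets) (count-never subsets))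
                        (count-cliques n (shift H) (U ∘ suc) zero)
  split (suc i) = trans (+-comm (count (λ S → isCliqueIn H U (suc i) (true ∷ S)) subsets) _)
    (cong₂ _+_ (count-cliques n (shift H) (U ∘ suc) (suc i)) (count-containing-first n H U i))

does-≟-true : ∀ b → does (b Bool.≟ true) ≡ b
does-≟-true true  = refl
does-≟-true false = refl

fClique≡cliques : ∀ {n} (G : Graph n) (H : ℕ → ℕ → Bool) →
  (∀ x y → adj G x y ≡ H (toℕ x) (toℕ y)) → ∀ i → fClique G i ≡ cliques n H (λ _ → true) i
fClique≡cliques {n} G H G≗H i =
  trans (length-filter≡count _ (isCliqueIn H (λ _ → true) i) agree (allSubsets n))
        (count-cliques n H (λ _ → true) i)
  where
  agree : ∀ S → does ((∣ S ∣ ℕ.≟ i) ×-dec (isClique G S Bool.≟ true)) ≡ isCliqueIn H (λ _ → true) i S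
  agree S = cong ((∣ S ∣ ≡ᵇ i) ∧_) (begin
      does (isClique G S Bool.≟ true)  ≡⟨ does-≟-true (isClique G S) ⟩
      isClique G S                      ≡⟨ isClique≡cliqueℕ G H G≗H S ⟩
      cliqueℕ S H                       ≡⟨ cong (_∧ cliqueℕ S H) (sym (within-everything S)) ⟩
      within S (λ _ → true) ∧ cliqueℕ S H ∎)
    where open ≡-Reasoning

cliques-cong : ∀ n {H H′ : ℕ → ℕ → Bool} {U U′ : ℕ → Bool} i →
  (∀ x y → H x y ≡ H′ x y) → (∀ x → U x ≡ U′ x) → cliques n H U i ≡ cliques n H′ U′ i
cliques-cong n       zero    H≗H′ U≗U′ = refl
cliques-cong zero    (suc i) H≗H′ U≗U′ = refl
cliques-cong (suc n) {U′ = U′} (suc i) H≗H′ U≗U′ rewrite U≗U′ 0 =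
  cong₂ _+_ (cliques-cong n (suc i) (λ x y → H≗H′ (suc x) (suc y)) (U≗U′ ∘ suc))
            (cong (λ c → if U′ 0 then c else 0)
                  (cliques-cong n i (λ x y → H≗H′ (suc x) (suc y))
                     (λ y → cong₂ _∧_ (U≗U′ (suc y)) (cong₂ _∧_ (H≗H′ 0 (suc y)) (H≗H′ (suc y) 0)))))

cliques-inside-nothing : ∀ n H U i → (∀ x → U x ≡ false) → cliques n H U (suc i) ≡ 0
cliques-inside-nothing zero    H U i U≗∅ = refl
cliques-inside-nothing (suc n) H U i U≗∅ rewrite U≗∅ 0 =
  trans (+-identityʳ _) (cliques-inside-nothing n (shift H) (U ∘ suc) i (U≗∅ ∘ suc))

-- attachment L j : the number of clique vertices to which the extra vertex
-- with index j is attached, i.e. the j-th entry of L (0 past the end).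
attachment : List ℕ → ℕ → ℕ
attachment L = List.foldr (λ x r j → if j ≡ᵇ 0 then x else r (j ∸ 1)) (λ _ → 0) L

attachAdj : ℕ → List ℕ → ℕ → ℕ → Bool
attachAdj a L i j = not (i ≡ᵇ j) ∧
  ( ((i <ᵇ a) ∧ (j <ᵇ a))
  ∨ ((i <ᵇ a) ∧ not (j <ᵇ a) ∧ (i <ᵇ attachment L (j ∸ a)))
  ∨ ((j <ᵇ a) ∧ not (i <ᵇ a) ∧ (j <ᵇ attachment L (i ∸ a))) )

adj-attachGraph : ∀ a L (x y : Fin (a + length L)) → adj (attachGraph a L) x y ≡ attachAdj a L (toℕ x) (toℕ y)
adj-attachGraph a L x y = refl

attachment-pred : ∀ L j → attachment (map pred L) j ≡ pred (attachment L j)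
attachment-pred []      j       = refl
attachment-pred (x ∷ L) zero    = refl
attachment-pred (x ∷ L) (suc j) = attachment-pred L j

<ᵇ-pred : ∀ i x → (suc i <ᵇ x) ≡ (i <ᵇ pred x)
<ᵇ-pred i zero    = refl
<ᵇ-pred i (suc x) = refl

-- Removing clique vertex 0 leaves an (a-1)-clique in which every extra
-- vertex has lost one attachment.
attachAdj-shift : ∀ a L i j → shift (attachAdj (suc a) L) i j ≡ attachAdj a (map pred L) i j
attachAdj-shift a L i j
  rewrite attachment-pred L (j ∸ a) | attachment-pred L (i ∸ a)
        | <ᵇ-pred i (attachment L (j ∸ a)) | <ᵇ-pred j (attachment L (i ∸ a)) = refl

attachAdj-edgeless : ∀ L i j → attachAdj 0 L i j ≡ false
attachAdj-edgeless L i j = ∧-zeroʳ (not (i ≡ᵇ j))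

cliqueOr : ℕ → (ℕ → Bool) → ℕ → Bool
cliqueOr a V x = if x <ᵇ a then true else V (x ∸ a)

neighbourhood-of-first : ∀ a L V y →
  cliqueOr (suc a) V (suc y) ∧ adjacentToFirst (attachAdj (suc a) L) y
    ≡ cliqueOr a (λ j → V j ∧ (0 <ᵇ attachment L j)) y
neighbourhood-of-first a L V y with y <ᵇ a | 0 <ᵇ attachment L (y ∸ a)
... | true  | _     = refl
... | false | true  = refl
... | false | false = refl

binomialSum : List ℕ → (ℕ → Bool) → ℕ → ℕ
binomialSum []      V i = 0
binomialSum (x ∷ L) V i = (if V 0 then x C i else 0) + binomialSum L (V ∘ suc) i

-- Both sides count the indices j with V j.
binomialSum-pred-0 : ∀ L V → binomialSum (map pred L) V 0 ≡ binomialSum L V 0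
binomialSum-pred-0 []      V = refl
binomialSum-pred-0 (x ∷ L) V = cong (_ +_) (binomialSum-pred-0 L (V ∘ suc))

-- Pascal's rule applied entrywise: (x-1 choose i+1) + [x > 0] (x-1 choose i) = x choose i+1.
binomialSum-pascal : ∀ L V i →
  binomialSum (map pred L) V (suc i) + binomialSum (map pred L) (λ j → V j ∧ (0 <ᵇ attachment L j)) i
    ≡ binomialSum L V (suc i)
binomialSum-pascal []      V i = refl
binomialSum-pascal (x ∷ L) V i =
  trans (+-interchange (if V 0 then pred x C suc i else 0) (binomialSum (map pred L) (V ∘ suc) (suc i))
                       (if V 0 ∧ (0 <ᵇ x) then pred x C i else 0) _)
        (cong₂ _+_ (entry (V 0) x) (binomialSum-pascal L (V ∘ suc) i))
  where
  entry : ∀ v x → (if v then pred x C suc i else 0) + (if v ∧ (0 <ᵇ x) then pred x C i else 0)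
                    ≡ (if v then x C suc i else 0)
  entry false x       = refl
  entry true  zero    = +-identityʳ _
  entry true  (suc x) = trans (+-comm (x C suc i) (x C i)) (nCk+nC[k+1]≡[n+1]C[k+1] x i)

-- With no clique, the (i+1)-cliques are the single allowed vertices, each
-- of which has attachment number 0.
cliques-edgeless : ∀ L V i → All (_≤ 0) L →
  cliques (length L) (λ _ _ → false) V (suc i) ≡ binomialSum L V i
cliques-edgeless []      V i []           = refl
cliques-edgeless (0 ∷ L) V i (z≤n ∷ L≤0) =
  trans (+-comm (cliques (length L) (λ _ _ → false) (V ∘ suc) (suc i)) _)
        (cong₂ _+_ (alone (V 0) i) (cliques-edgeless L (V ∘ suc) i L≤0))
  where
  nothing : ℕ → Bool
  nothing y = V (suc y) ∧ (false ∧ false)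
  alone : ∀ v i → (if v then cliques (length L) (λ _ _ → false) nothing i else 0) ≡ (if v then 0 C i else 0)
  alone false i       = refl
  alone true  zero    = refl
  alone true  (suc i) = cliques-inside-nothing (length L) _ nothing i (λ y → ∧-zeroʳ (V (suc y)))

All-pred : ∀ {a L} → All (_≤ suc a) L → All (_≤ a) (map pred L)
All-pred = gmap⁺ pred-mono-≤

length-pred : ∀ {a n} L → suc n ≡ suc a + length L → n ≡ a + length (map pred L)
length-pred {a} L eq = trans (suc-injective eq) (cong (a +_) (sym (length-map pred L)))

-- Induction on a removes clique vertex 0.
cliques-attach : ∀ a L V i n → n ≡ a + length L → All (_≤ a) L →
  cliques n (attachAdj a L) (cliqueOr a V) (suc i) ≡ a C suc i + binomialSum L V i
cliques-attach zero L V i n refl L≤0 =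
  trans (cliques-cong (length L) (suc i) (attachAdj-edgeless L) (λ _ → refl)) (cliques-edgeless L V i L≤0)
cliques-attach (suc a) L V i zero () L≤a
cliques-attach (suc a) L V zero (suc n) n≡ L≤a = begin
    cliques n (shift (attachAdj (suc a) L)) (cliqueOr a V) 1 + 1
  ≡⟨ cong (_+ 1) (trans (cliques-cong n 1 (attachAdj-shift a L) (λ _ → refl))
                        (cliques-attach a L′ V zero n (length-pred L n≡) (All-pred L≤a))) ⟩
    a C 1 + binomialSum L′ V 0 + 1
  ≡⟨ cong₂ (λ u w → u + w + 1) (nC1≡n a) (binomialSum-pred-0 L V) ⟩
    a + binomialSum L V 0 + 1
  ≡⟨ +-comm (a + binomialSum L V 0) 1 ⟩
    suc a + binomialSum L V 0
  ≡⟨ cong (_+ binomialSum L V 0) (sym (nC1≡n (suc a))) ⟩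
    suc a C 1 + binomialSum L V 0
  ∎
  where
  open ≡-Reasoning
  L′ : List ℕ
  L′ = map pred L
cliques-attach (suc a) L V (suc i) (suc n) n≡ L≤a = begin
    cliques n (shift (attachAdj (suc a) L)) (cliqueOr a V) (suc (suc i))
      + cliques n (shift (attachAdj (suc a) L)) (λ y → cliqueOr (suc a) V (suc y) ∧ adjacentToFirst (attachAdj (suc a) L) y) (suc i)
  ≡⟨ cong₂ _+_ (trans (cliques-cong n (suc (suc i)) (attachAdj-shift a L) (λ _ → refl))
                      (cliques-attach a L′ V (suc i) n (length-pred L n≡) (All-pred L≤a)))
               (trans (cliques-cong n (suc i) (attachAdj-shift a L) (neighbourhood-of-first a L V))
                      (cliques-attach a L′ V″ i n (length-pred L n≡) (All-pred L≤a))) ⟩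
    (a C suc (suc i) + binomialSum L′ V (suc i)) + (a C suc i + binomialSum L′ V″ i)
  ≡⟨ +-interchange (a C suc (suc i)) (binomialSum L′ V (suc i)) (a C suc i) (binomialSum L′ V″ i) ⟩
    (a C suc (suc i) + a C suc i) + (binomialSum L′ V (suc i) + binomialSum L′ V″ i)
  ≡⟨ cong₂ _+_ (trans (+-comm (a C suc (suc i)) (a C suc i)) (nCk+nC[k+1]≡[n+1]C[k+1] a (suc i)))
               (binomialSum-pascal L V i) ⟩
    suc a C suc (suc i) + binomialSum L V (suc i)
  ∎
  where
  open ≡-Reasoning
  L′ : List ℕ
  L′ = map pred L
  V″ : ℕ → Bool
  V″ j = V j ∧ (0 <ᵇ attachment L j)

fClique-attachGraph : ∀ a L i → All (_≤ a) L →
  fClique (attachGraph a L) (suc i) ≡ a C suc i + binomialSum L (λ _ → true) i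
fClique-attachGraph a L i L≤a =
  trans (fClique≡cliques (attachGraph a L) (attachAdj a L) (adj-attachGraph a L) (suc i))
        (trans (cliques-cong (a + length L) (suc i) (λ _ _ → refl) everything-allowed)
               (cliques-attach a L (λ _ → true) i (a + length L) refl L≤a))
  where
  everything-allowed : ∀ x → true ≡ cliqueOr a (λ _ → true) x
  everything-allowed x with x <ᵇ a
  ... | true  = refl
  ... | false = refl

C-mono : ∀ k {m n} → m ≤ n → m C k ≤ n C k
C-mono k {m} {n} m≤n = subst (λ x → m C k ≤ x C k) (m∸n+n≡m m≤n) (go (n ∸ m))
  where
  step : ∀ x k → x C k ≤ suc x C k
  step x zero    = ≤-refl
  step x (suc k) = subst (x C suc k ≤_) (nCk+nC[k+1]≡[n+1]C[k+1] x k) (m≤n+m (x C suc k) (x C k))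
  go : ∀ d → m C k ≤ (d + m) C k
  go zero    = ≤-refl
  go (suc d) = ≤-trans (go d) (step (d + m) k)

C-pos : ∀ {k n} → k ≤ n → 1 ≤ n C k
C-pos {zero}          k≤n       = ≤-refl
C-pos {suc k} {suc n} (s≤s k≤n) =
  subst (1 ≤_) (nCk+nC[k+1]≡[n+1]C[k+1] n k) (≤-trans (C-pos k≤n) (m≤m+n (n C k) _))

-- n ≤ (n choose k+1) + k + 1, so the search in top never runs out of range.
C-lower : ∀ n k → n ≤ n C suc k + suc k
C-lower zero    k = z≤n
C-lower (suc n) k with k ≤? n
... | yes k≤n = subst (λ x → suc n ≤ x + suc k) (nCk+nC[k+1]≡[n+1]C[k+1] n k)
                  (subst (suc n ≤_) (sym (+-assoc (n C k) _ _)) (+-mono-≤ (C-pos k≤n) (C-lower n k)))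
... | no  k≰n = ≤-trans (≰⇒> k≰n) (≤-trans (n≤1+n k) (m≤n+m (suc k) _))

-- If m < (b choose k) then, by Pascal's rule,
-- (b choose k+1) + m < (b+1 choose k+1) ≤ (a choose k+1) for every a > b.
pascal-gap : ∀ {a b m} k → b < a → m < b C k → b C suc k + m < a C suc k
pascal-gap {a} {b} {m} k b<a m<bCk = ≤-trans
  (subst (suc (b C suc k + m) ≤_) (trans (+-comm (b C suc k) (b C k)) (nCk+nC[k+1]≡[n+1]C[k+1] b k))
         (+-monoʳ-< (b C suc k) m<bCk))
  (C-mono (suc k) b<a)

topBelow-lower : ∀ j m B → topBelow (suc j) m B C suc j ≤ m
topBelow-lower j m zero    = z≤n
topBelow-lower j m (suc B) with suc B C suc j ≤ᵇ m in found
... | true  = ≤ᵇ⇒≤ _ _ (subst T (sym found) tt)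
... | false = topBelow-lower j m B

topBelow-maximal : ∀ j m B n → topBelow j m B < n → n ≤ B → m < n C j
topBelow-maximal j m zero    n below n≤0 = ⊥-elim (<⇒≱ below (≤-trans n≤0 z≤n))
topBelow-maximal j m (suc B) n below n≤B with suc B C j ≤ᵇ m in found
... | true  = ⊥-elim (<⇒≱ below n≤B)
... | false with m≤n⇒m<n∨m≡n n≤B
...   | inj₁ n<B  = topBelow-maximal j m B n below (s≤s⁻¹ n<B)
...   | inj₂ refl = ≰⇒> (λ le → subst T found (≤⇒≤ᵇ le))

top-lower : ∀ j m → top (suc j) m C suc j ≤ m
top-lower j m = topBelow-lower j m (m + suc j)

top-upper : ∀ j m → m < suc (top (suc j) m) C suc j
top-upper j m with suc (top (suc j) m) ≤? m + suc j
... | yes in-range = topBelow-maximal (suc j) m (m + suc j) _ ≤-refl in-range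
... | no  beyond   = +-cancelʳ-< (suc j) m _ (<-≤-trans (≰⇒> beyond) (C-lower (suc (top (suc j) m)) j))

top-unique : ∀ j m x → x C suc j ≤ m → m < suc x C suc j → top (suc j) m ≡ x
top-unique j m x lower upper with <-cmp (top (suc j) m) x
... | tri≈ _ eq _ = eq
... | tri< lt _ _ = ⊥-elim (<⇒≱ (top-upper j m) (≤-trans (C-mono (suc j) lt) lower))
... | tri> _ _ gt = ⊥-elim (<⇒≱ upper (≤-trans (C-mono (suc j) gt) (top-lower j m)))

Σbinomial : List ℕ → ℕ → ℕ
Σbinomial L i = binomialSum L (λ _ → true) i

Σbinomial-++ : ∀ L L′ i → Σbinomial (L ++ L′) i ≡ Σbinomial L i + Σbinomial L′ i
Σbinomial-++ []      L′ i = refl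
Σbinomial-++ (x ∷ L) L′ i = trans (cong (x C i +_) (Σbinomial-++ L L′ i)) (sym (+-assoc (x C i) _ _))

Σbinomial-replicate : ∀ e x i → Σbinomial (replicate e x) i ≡ e * (x C i)
Σbinomial-replicate zero    x i = refl
Σbinomial-replicate (suc e) x i = cong (x C i +_) (Σbinomial-replicate e x i)

module Greedy (j : ℕ) where

  k : ℕ
  k = suc (suc j)

  g-lower : ∀ M → g k M C suc j ≤ M
  g-lower = top-lower j

  g-positive : ∀ M → 1 ≤ M → 1 ≤ g k M C suc j
  g-positive M 1≤M with suc j ≤? g k M
  ... | yes j<g = C-pos j<g
  ... | no  j≮g = ⊥-elim (<⇒≱ (top-upper j M)
        (≤-trans (C-mono (suc j) (≰⇒> j≮g)) (≤-trans (≤-reflexive (nCn≡1 (suc j))) 1≤M)))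

  remainder : ℕ → ℕ
  remainder M = M ∸ g k M C suc j

  remainder-< : ∀ M → remainder (suc M) ≤ M
  remainder-< M = ∸-monoʳ-≤ (suc M) (g-positive (suc M) (s≤s z≤n))

  nsFuel-sum : ∀ F M → M ≤ F → Σbinomial (nsFuel k F M) (suc j) ≡ M
  nsFuel-sum zero    zero    _         = refl
  nsFuel-sum (suc F) zero    _         = refl
  nsFuel-sum (suc F) (suc M) (s≤s M≤F) =
    trans (cong (g k (suc M) C suc j +_) (nsFuel-sum F _ (≤-trans (remainder-< M) M≤F)))
          (m+[n∸m]≡n (g-lower (suc M)))

  nsFuel-c : ∀ i F M → Σbinomial (nsFuel k F M) i ≡ cFuel (suc i) k F M
  nsFuel-c i zero    M       = refl
  nsFuel-c i (suc F) zero    = refl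
  nsFuel-c i (suc F) (suc M) = cong (g k (suc M) C i +_) (nsFuel-c i F _)

  nsFuel-fuel : ∀ F F′ M → M ≤ F → M ≤ F′ → nsFuel k F M ≡ nsFuel k F′ M
  nsFuel-fuel zero    zero     zero    _ _ = refl
  nsFuel-fuel zero    (suc F′) zero    _ _ = refl
  nsFuel-fuel (suc F) zero     zero    _ _ = refl
  nsFuel-fuel (suc F) (suc F′) zero    _ _ = refl
  nsFuel-fuel (suc F) (suc F′) (suc M) (s≤s M≤F) (s≤s M≤F′) =
    cong (g k (suc M) ∷_) (nsFuel-fuel F F′ _ (≤-trans (remainder-< M) M≤F) (≤-trans (remainder-< M) M≤F′))

  nsFuel-bounded : ∀ a F M → M < a C suc j → All (_≤ a) (nsFuel k F M)
  nsFuel-bounded a zero    M       _   = []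
  nsFuel-bounded a (suc F) zero    _   = []
  nsFuel-bounded a (suc F) (suc M) M<a = g≤a ∷ nsFuel-bounded a F _ (≤-<-trans (m∸n≤m (suc M) (g k (suc M) C suc j)) M<a)
    where
    g≤a : g k (suc M) ≤ a
    g≤a with g k (suc M) ≤? a
    ... | yes g≤a = g≤a
    ... | no  g≰a = ⊥-elim (<⇒≱ M<a (≤-trans (C-mono (suc j) (<⇒≤ (≰⇒> g≰a))) (g-lower (suc M))))

  -- For M = (b choose j+1) + m with m < (b choose j) the expansion starts
  -- with b and continues with the expansion of m, so summing (x choose i)
  -- over it gives (b choose i) + c_{i+1}^k(m) (or 0 in the degenerate case M = 0).
  expansion-Σbinomial : ∀ {b m} i M → M ≡ b C suc j + m → m < b C j →
    Σbinomial (nsFuel k M M) i ≤ b C i + c (suc i) k m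
  expansion-Σbinomial i zero    _  _      = z≤n
  expansion-Σbinomial {b} {m} i (suc M) M≡ m<bCj = ≤-reflexive (begin
      g k (suc M) C i + Σbinomial (nsFuel k M (remainder (suc M))) i
    ≡⟨ cong (λ x → x C i + Σbinomial (nsFuel k M (suc M ∸ x C suc j)) i) g≡b ⟩
      b C i + Σbinomial (nsFuel k M (suc M ∸ b C suc j)) i
    ≡⟨ cong (λ r → b C i + Σbinomial (nsFuel k M r) i) rest≡m ⟩
      b C i + Σbinomial (nsFuel k M m) i
    ≡⟨ cong (λ L → b C i + Σbinomial L i) (nsFuel-fuel M m m m≤M ≤-refl) ⟩
      b C i + Σbinomial (nsFuel k m m) i
    ≡⟨ cong (b C i +_) (nsFuel-c i m m) ⟩
      b C i + c (suc i) k m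
    ∎)
    where
    open ≡-Reasoning
    g≡b : g k (suc M) ≡ b
    g≡b = top-unique j (suc M) b (subst (b C suc j ≤_) (sym M≡) (m≤m+n _ m))
                                 (subst (_< suc b C suc j) (sym M≡) (pascal-gap j ≤-refl m<bCj))
    rest≡m : suc M ∸ b C suc j ≡ m
    rest≡m = trans (cong (_∸ b C suc j) M≡) (m+n∸m≡n (b C suc j) m)
    m≤M : m ≤ M
    m≤M = subst (_≤ M) (trans (cong (λ x → suc M ∸ x C suc j) g≡b) rest≡m) (remainder-< M)

-- The construction for k = j + 2 and p = i + 1 ≤ k - 1, applied to
-- v = (a choose k) + (b choose k-1) + m with b < a and m < (b choose k-2).
module Construction (j i a b m : ℕ) (i≤j : i ≤ j) (b<a : b < a) (m<bCj : m < b C j) where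
  open Greedy j

  v : ℕ
  v = a C k + b C suc j + m

  -- m_0 < (a choose k-1), which pins down n_0 and bounds the n_i
  m₀-bound : b C suc j + m < a C suc j
  m₀-bound = pascal-gap j b<a m<bCj

  n₀≡a : n₀ k v ≡ a
  n₀≡a = top-unique (suc j) v a (≤-trans (m≤m+n (a C k) _) (m≤m+n _ m)) (begin-strict
      a C k + b C suc j + m    ≡⟨ +-assoc (a C k) (b C suc j) m ⟩
      a C k + (b C suc j + m)  <⟨ +-monoʳ-< (a C k) m₀-bound ⟩
      a C k + a C suc j        ≡⟨ +-comm (a C k) (a C suc j) ⟩
      a C suc j + a C k        ≡⟨ nCk+nC[k+1]≡[n+1]C[k+1] a (suc j) ⟩
      suc a C k                ∎)
    where open ≤-Reasoning

  m₀≡ : m₀ k v ≡ b C suc j + m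
  m₀≡ = begin
      v ∸ n₀ k v C k                 ≡⟨ cong (λ x → v ∸ x C k) n₀≡a ⟩
      a C k + b C suc j + m ∸ a C k  ≡⟨ cong (_∸ a C k) (+-assoc (a C k) (b C suc j) m) ⟩
      a C k + (b C suc j + m) ∸ a C k ≡⟨ m+n∸m≡n (a C k) _ ⟩
      b C suc j + m                  ∎
    where open ≡-Reasoning

  -- i ≤ j ≤ b < a: the (p-1)-attachments fit into the clique
  i<a : i < a
  i<a with j ≤? b
  ... | yes j≤b = ≤-<-trans (≤-trans i≤j j≤b) b<a
  ... | no  j≰b = ⊥-elim (n≮0 (subst (m <_) (k>n⇒nCk≡0 (≰⇒> j≰b)) m<bCj))

  ns-bounded : All (_≤ n₀ k v) (ns k v)
  ns-bounded = subst (λ x → All (_≤ x) (ns k v)) (sym n₀≡a)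
    (nsFuel-bounded a (m₀ k v) (m₀ k v) (subst (_< a C suc j) (sym m₀≡) m₀-bound))

  i≤n₀ : i ≤ n₀ k v
  i≤n₀ = subst (i ≤_) (sym n₀≡a) (<⇒≤ i<a)

  faces-G₀ : ∀ i′ → fClique (G₀ k v) (suc i′) ≡ a C suc i′ + Σbinomial (ns k v) i′
  faces-G₀ i′ = trans (fClique-attachGraph (n₀ k v) (ns k v) i′ ns-bounded)
                      (cong (λ x → x C suc i′ + Σbinomial (ns k v) i′) n₀≡a)

  faces-Gfinal : ∀ e i′ → fClique (Gfinal k (suc i) v e) (suc i′) ≡ fClique (G₀ k v) (suc i′) + e * (i C i′)
  faces-Gfinal e i′ = begin
      fClique (Gfinal k (suc i) v e) (suc i′)
    ≡⟨ fClique-attachGraph (n₀ k v) (ns k v ++ replicate e i) i′ (++⁺ ns-bounded (replicate⁺ e i≤n₀)) ⟩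
      n₀ k v C suc i′ + Σbinomial (ns k v ++ replicate e i) i′
    ≡⟨ cong (n₀ k v C suc i′ +_) (trans (Σbinomial-++ (ns k v) (replicate e i) i′)
                                        (cong (Σbinomial (ns k v) i′ +_) (Σbinomial-replicate e i i′))) ⟩
      n₀ k v C suc i′ + (Σbinomial (ns k v) i′ + e * (i C i′))
    ≡⟨ sym (+-assoc (n₀ k v C suc i′) _ _) ⟩
      n₀ k v C suc i′ + Σbinomial (ns k v) i′ + e * (i C i′)
    ≡⟨ cong (_+ e * (i C i′)) (sym (fClique-attachGraph (n₀ k v) (ns k v) i′ ns-bounded)) ⟩
      fClique (G₀ k v) (suc i′) + e * (i C i′)
    ∎
    where open ≡-Reasoning

  G₀-k-faces : fClique (G₀ k v) k ≡ v
  G₀-k-faces = begin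
      fClique (G₀ k v) k                      ≡⟨ faces-G₀ (suc j) ⟩
      a C k + Σbinomial (ns k v) (suc j)      ≡⟨ cong (a C k +_) (nsFuel-sum (m₀ k v) (m₀ k v) ≤-refl) ⟩
      a C k + m₀ k v                          ≡⟨ cong (a C k +_) m₀≡ ⟩
      a C k + (b C suc j + m)                 ≡⟨ sym (+-assoc (a C k) (b C suc j) m) ⟩
      v                                       ∎
    where open ≡-Reasoning

  G₀-p-faces : fClique (G₀ k v) (suc i) ≤ a C suc i + b C i + c (suc i) k m
  G₀-p-faces = begin
      fClique (G₀ k v) (suc i)                ≡⟨ faces-G₀ i ⟩
      a C suc i + Σbinomial (ns k v) i        ≤⟨ +-monoʳ-≤ (a C suc i) (expansion-Σbinomial i (m₀ k v) m₀≡ m<bCj) ⟩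
      a C suc i + (b C i + c (suc i) k m)     ≡⟨ sym (+-assoc (a C suc i) (b C i) _) ⟩
      a C suc i + b C i + c (suc i) k m       ∎
    where open ≤-Reasoning

  Gfinal-k-faces : ∀ e → fClique (Gfinal k (suc i) v e) k ≡ v
  Gfinal-k-faces e = begin
      fClique (Gfinal k (suc i) v e) k        ≡⟨ faces-Gfinal e (suc j) ⟩
      fClique (G₀ k v) k + e * (i C suc j)    ≡⟨ cong (λ x → fClique (G₀ k v) k + e * x) (k>n⇒nCk≡0 (s≤s i≤j)) ⟩
      fClique (G₀ k v) k + e * 0              ≡⟨ cong (fClique (G₀ k v) k +_) (*-zeroʳ e) ⟩
      fClique (G₀ k v) k + 0                  ≡⟨ +-identityʳ _ ⟩
      fClique (G₀ k v) k                      ≡⟨ G₀-k-faces ⟩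
      v                                       ∎
    where open ≡-Reasoning

  Gfinal-p-faces : ∀ e → fClique (Gfinal k (suc i) v e) (suc i) ≡ fClique (G₀ k v) (suc i) + e
  Gfinal-p-faces e = begin
      fClique (Gfinal k (suc i) v e) (suc i)  ≡⟨ faces-Gfinal e i ⟩
      fClique (G₀ k v) (suc i) + e * (i C i)  ≡⟨ cong (λ x → fClique (G₀ k v) (suc i) + e * x) (nCn≡1 i) ⟩
      fClique (G₀ k v) (suc i) + e * 1        ≡⟨ cong (fClique (G₀ k v) (suc i) +_) (*-identityʳ e) ⟩
      fClique (G₀ k v) (suc i) + e            ∎
    where open ≡-Reasoning

theorem2p7 : (k p v w : ℕ) → 1 ≤ k → 1 ≤ p → 1 ≤ v → 1 ≤ w → k > p →
    (a b m : ℕ) → v ≡ a C k + b C (k ∸ 1) + m → a > b → b C (k ∸ 2) > m →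
    w ≥ a C p + b C (p ∸ 1) + c p k m →
    (fClique (G₀ k v) p ≤ w)
    × (fClique (Gfinal k p v (w ∸ fClique (G₀ k v) p)) k ≡ v
    × fClique (Gfinal k p v (w ∸ fClique (G₀ k v) p)) p ≡ w)
theorem2p7 k             zero    v w _ () _ _ _           a b m _    _   _     _
theorem2p7 zero          (suc i) v w _ _  _ _ ()          a b m _    _   _     _
theorem2p7 (suc zero)    (suc i) v w _ _  _ _ (s≤s ())    a b m _    _   _     _
theorem2p7 (suc (suc j)) (suc i) v w _ _  _ _ (s≤s (s≤s i≤j)) a b m refl b<a m<bCj w≥bound =
  G₀-faces≤w , Gfinal-k-faces e , trans (Gfinal-p-faces e) (m+[n∸m]≡n G₀-faces≤w)
  where
  open Construction j i a b m i≤j b<a m<bCj hiding (v)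
  G₀-faces≤w : fClique (G₀ (suc (suc j)) v) (suc i) ≤ w
  G₀-faces≤w = ≤-trans G₀-p-faces w≥bound
  e : ℕ
  e = w ∸ fClique (G₀ (suc (suc j)) v) (suc i)
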